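{- Let $G$ be a finite abelian group of order $N$. Then for every integer $m$ with $1 \leq m \leq N/2$, \[\rho_\pm(G, m, 2) \geq \min\{\rho_G^-(m),\ \rho_G^-(2m) - 1\}.\]
   Context: For subsets $A,B$ of an abelian group $G$, $A - B = \{a - b \mid a \in A, b \in B\}$, and for $1 \le r \le |G|$, $\rho_G^-(r) = \min\{|A - A| \mid A \subseteq G, |A| = r\}$. For a finite subset $A = \{a_1, \ldots, a_m\}$ (distinct elements) of $G$, the $2$-fold signed sumset is $2_\pm A = \{\lambda_1 a_1 + \cdots + \lambda_m a_m \mid \lambda_i \in \mathbb{Z}, \sum_i |\lambda_i| = 2\}$, i.e. the set of all elements $\pm 2a$ with $a \in A$ and $\pm a \pm b$ with $a, b \in A$, $a \neq b$. For $1 \le m \le |G|$, $\rho_\pm(G, m, 2) = \min\{|2_\pm A| \mid A \subseteq G, |A| = m\}$. -}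

module Defs where

open import Level using (Level; _⊔_) renaming (suc to lsuc)
open import Data.Nat using (ℕ; zero; suc; _⊓_)
open import Data.Fin using (Fin)
open import Data.Fin.Properties using (any?) renaming (_≟_ to _≟ᶠ_)
open import Data.Fin.Subset using (Subset; _∈_; ∣_∣; inside; outside)
open import Data.Fin.Subset.Properties using (_∈?_)
open import Data.Vec using (Vec; []; _∷_; tabulate)
open import Data.List using (List; []; _∷_; _++_; map; filter; foldr)
open import Data.Product using (Σ; ∃; _×_; _,_; proj₁; proj₂)
open import Data.Sum using (_⊎_)
open import Algebra.Bundles using (AbelianGroup)
open import Function.Bundles using (Bijection)
open import Relation.Nullary using (¬_; Dec; yes; no; does)
open import Relation.Nullary.Decidable using (_×-dec_; _⊎-dec_; ¬?)
open import Relation.Binary using (Decidable)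
open import Relation.Binary.PropositionalEquality as ≡ using (_≡_)
import Data.Nat as ℕ

-- Elements are identified with indices in Fin order.
record FiniteAbelianGroup (c ℓ : Level) : Set (lsuc (c ⊔ ℓ)) where
  field
    abGroup : AbelianGroup c ℓ
    order : ℕ
    enum  : Bijection (≡.setoid (Fin order)) (AbelianGroup.setoid abGroup)

  open AbelianGroup abGroup public
  open Bijection enum public using (to; injective; strictlySurjective)

  _≈?_ : Decidable _≈_
  x ≈? y with strictlySurjective x | strictlySurjective y
  ... | i , ix | j , jy with i ≟ᶠ j
  ...   | yes ≡.refl = yes (trans (sym ix) jy)
  ...   | no i≢j = no (λ x≈y → i≢j (injective (trans ix (trans x≈y (sym jy)))))

  el : Fin order → Carrier
  el = to

  DiffSet : Subset order → Subset order
  DiffSet A = tabulate λ k → does (any? λ i → any? λ j →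
      (i ∈? A) ×-dec ((j ∈? A) ×-dec (el k ≈? (el i ∙ el j ⁻¹))))

  SignedSumset2 : Subset order → Subset order
  SignedSumset2 A = tabulate λ k → does (
      (any? λ i → (i ∈? A) ×-dec
          ((el k ≈? (el i ∙ el i)) ⊎-dec (el k ≈? ((el i ∙ el i) ⁻¹))))
      ⊎-dec
      (any? λ i → any? λ j →
          (i ∈? A) ×-dec ((j ∈? A) ×-dec (¬? (i ≟ᶠ j) ×-dec
            (   (el k ≈? (el i ∙ el j))
            ⊎-dec (el k ≈? (el i ∙ el j ⁻¹))
            ⊎-dec (el k ≈? (el i ⁻¹ ∙ el j))
            ⊎-dec (el k ≈? (el i ⁻¹ ∙ el j ⁻¹)))))))

allSubsets : (n : ℕ) → List (Subset n)
allSubsets zero = [] ∷ []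
allSubsets (suc n) = map (inside ∷_) (allSubsets n) ++ map (outside ∷_) (allSubsets n)

-- minimum of f over all subsets of size r of Fin n
-- (default value n for the empty minimum; all values considered below are ≤ n,
--  so for 1 ≤ r ≤ n this is the true minimum)
minOverSize : (n r : ℕ) → (Subset n → ℕ) → ℕ
minOverSize n r f = foldr (λ A acc → f A ⊓ acc) n (filter (λ A → ∣ A ∣ ℕ.≟ r) (allSubsets n))

module _ {c ℓ : Level} (G : FiniteAbelianGroup c ℓ) where
  open FiniteAbelianGroup G

  ρ⁻ : ℕ → ℕ
  ρ⁻ r = minOverSize order r (λ A → ∣ DiffSet A ∣)

  ρ± : ℕ → ℕ
  ρ± m = minOverSize order m (λ A → ∣ SignedSumset2 A ∣)

module Submission where

-- Fix A ⊆ G with |A| = m; it suffices to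
-- bound |2_± A| from below by min{ρ⁻(m), ρ⁻(2m) - 1}.
--   * If A meets -A, say a, -a ∈ A, then 0 = a + (-a) lies in 2_± A, and
--     every nonzero difference a - b (a ≠ b) lies in 2_± A by definition;
--     hence A - A ⊆ 2_± A and |2_± A| ≥ ρ⁻(m).
--   * Otherwise B = A ∪ -A is a disjoint union of 2m elements, and every
--     difference (±a) - (±b) of elements of B is either 0 or lies in 2_± A;
--     hence B - B ⊆ {0} ∪ 2_± A and |2_± A| ≥ ρ⁻(2m) - 1.
-- The file first records generic facts about minima over subsets of a given
-- size (minOverSize), about cardinalities of subsets of Fin n, and about
-- subsets defined by a decision procedure.
-- The theorem is the greatest-lower-bound property of the minimum applied to
-- the per-subset bound.

open import Defs
open import Data.Nat using (ℕ; _*_; _≤_; _⊓_; _∸_)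
open import Level using (Level)

open import Data.Nat using (suc; _+_; z≤n; s≤s)
import Data.Nat.Properties as ℕₚ
open import Data.Bool using (Bool; true; false; not)
open import Data.Fin using (Fin)
open import Data.Fin.Properties using (any?) renaming (_≟_ to _≟ᶠ_)
open import Data.Fin.Subset using (Subset; _∈_; ∣_∣; inside; outside; _∪_; _⊆_; ⁅_⁆)
open import Data.Fin.Subset.Properties
  using (p⊆q⇒∣p∣≤∣q∣; ∣⁅x⁆∣≡1; x∈⁅x⁆; x∈p∪q⁻; x∈p∪q⁺; _∈?_)
open import Data.Fin.Permutation using (Permutation; permutation; _⟨$⟩ʳ_)
open import Data.Vec using ([]; _∷_; tabulate; lookup; here; there)
open import Data.Vec.Properties using (lookup∘tabulate; []=⇒lookup; lookup⇒[]=)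
open import Data.List using (List; []; _∷_; filter; foldr)
open import Data.List.Membership.Propositional using () renaming (_∈_ to _∈ₗ_)
open import Data.List.Membership.Propositional.Properties using (∈-++⁺ˡ; ∈-++⁺ʳ; ∈-map⁺; ∈-filter⁺)
open import Data.List.Relation.Unary.All using (All; []; _∷_)
import Data.List.Relation.Unary.All as All
open import Data.List.Relation.Unary.All.Properties using (all-filter)
open import Data.List.Relation.Unary.Any using (here; there)
open import Data.Product using (∃; ∃₂; _×_; _,_; proj₁; proj₂)
open import Data.Sum using (_⊎_; inj₁; inj₂)
open import Data.Empty using (⊥; ⊥-elim)
open import Relation.Nullary using (¬_; Dec; yes; no; does)
open import Relation.Nullary.Decidable using (dec-true; _×-dec_; _⊎-dec_; ¬?)
open import Relation.Binary.PropositionalEquality as ≡ using (_≡_; refl)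
open import Algebra.Properties.CommutativeMonoid.Sum ℕₚ.+-0-commutativeMonoid
  using (sum; sum-permute; sum-cong-≗)

module _ {n : ℕ} (f : Subset n → ℕ) where

  foldMin : List (Subset n) → ℕ
  foldMin = foldr (λ A acc → f A ⊓ acc) n

  foldMin-≤ : ∀ {A} L → A ∈ₗ L → foldMin L ≤ f A
  foldMin-≤ (B ∷ L) (here refl) = ℕₚ.m⊓n≤m (f B) (foldMin L)
  foldMin-≤ (B ∷ L) (there A∈L) = ℕₚ.≤-trans (ℕₚ.m⊓n≤n (f B) (foldMin L)) (foldMin-≤ L A∈L)

  foldMin-≤-default : ∀ L → foldMin L ≤ n
  foldMin-≤-default []      = ℕₚ.≤-refl
  foldMin-≤-default (B ∷ L) = ℕₚ.≤-trans (ℕₚ.m⊓n≤n (f B) (foldMin L)) (foldMin-≤-default L)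

  foldMin-greatest : ∀ {g} L → g ≤ n → All (λ A → g ≤ f A) L → g ≤ foldMin L
  foldMin-greatest []      g≤n []           = g≤n
  foldMin-greatest (B ∷ L) g≤n (g≤fB ∷ g≤L) = ℕₚ.⊓-glb g≤fB (foldMin-greatest L g≤n g≤L)

allSubsets-complete : ∀ {n} (p : Subset n) → p ∈ₗ allSubsets n
allSubsets-complete []                = here refl
allSubsets-complete {suc n} (inside ∷ p)  = ∈-++⁺ˡ (∈-map⁺ (inside ∷_) (allSubsets-complete p))
allSubsets-complete {suc n} (outside ∷ p) =
  ∈-++⁺ʳ _ (∈-map⁺ (outside ∷_) (allSubsets-complete p))

module _ (n r : ℕ) (f : Subset n → ℕ) where

  private
    candidates : List (Subset n)
    candidates = filter (λ A → ∣ A ∣ ℕₚ.≟ r) (allSubsets n)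

  minOverSize-≤ : ∀ A → ∣ A ∣ ≡ r → minOverSize n r f ≤ f A
  minOverSize-≤ A ∣A∣≡r = foldMin-≤ f candidates
    (∈-filter⁺ (λ A → ∣ A ∣ ℕₚ.≟ r) (allSubsets-complete A) ∣A∣≡r)

  minOverSize-≤-default : minOverSize n r f ≤ n
  minOverSize-≤-default = foldMin-≤-default f candidates

  minOverSize-greatest : ∀ {g} → g ≤ n → (∀ A → ∣ A ∣ ≡ r → g ≤ f A) → g ≤ minOverSize n r f
  minOverSize-greatest g≤n bound = foldMin-greatest f candidates g≤n
    (All.map (λ {A} → bound A) (all-filter (λ A → ∣ A ∣ ℕₚ.≟ r) (allSubsets n)))

∣p∪q∣≤∣p∣+∣q∣ : ∀ {n} (p q : Subset n) → ∣ p ∪ q ∣ ≤ ∣ p ∣ + ∣ q ∣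
∣p∪q∣≤∣p∣+∣q∣ []            []            = z≤n
∣p∪q∣≤∣p∣+∣q∣ (inside ∷ p)  (inside ∷ q)  =
  s≤s (ℕₚ.≤-trans (∣p∪q∣≤∣p∣+∣q∣ p q) (ℕₚ.+-monoʳ-≤ ∣ p ∣ (ℕₚ.n≤1+n ∣ q ∣)))
∣p∪q∣≤∣p∣+∣q∣ (inside ∷ p)  (outside ∷ q) = s≤s (∣p∪q∣≤∣p∣+∣q∣ p q)
∣p∪q∣≤∣p∣+∣q∣ (outside ∷ p) (inside ∷ q)  =
  ℕₚ.≤-trans (s≤s (∣p∪q∣≤∣p∣+∣q∣ p q)) (ℕₚ.≤-reflexive (≡.sym (ℕₚ.+-suc ∣ p ∣ ∣ q ∣)))
∣p∪q∣≤∣p∣+∣q∣ (outside ∷ p) (outside ∷ q) = ∣p∪q∣≤∣p∣+∣q∣ p q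

Disjoint : ∀ {n} → Subset n → Subset n → Set
Disjoint p q = ∀ {k} → k ∈ p → k ∈ q → ⊥

∣p∪q∣≡∣p∣+∣q∣ : ∀ {n} (p q : Subset n) → Disjoint p q → ∣ p ∪ q ∣ ≡ ∣ p ∣ + ∣ q ∣
∣p∪q∣≡∣p∣+∣q∣ []            []            _    = refl
∣p∪q∣≡∣p∣+∣q∣ (inside ∷ p)  (inside ∷ q)  disj = ⊥-elim (disj here here)
∣p∪q∣≡∣p∣+∣q∣ (inside ∷ p)  (outside ∷ q) disj =
  ≡.cong suc (∣p∪q∣≡∣p∣+∣q∣ p q (λ k∈p k∈q → disj (there k∈p) (there k∈q)))
∣p∪q∣≡∣p∣+∣q∣ (outside ∷ p) (inside ∷ q)  disj =
  ≡.trans (≡.cong suc (∣p∪q∣≡∣p∣+∣q∣ p q (λ k∈p k∈q → disj (there k∈p) (there k∈q))))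
          (≡.sym (ℕₚ.+-suc ∣ p ∣ ∣ q ∣))
∣p∪q∣≡∣p∣+∣q∣ (outside ∷ p) (outside ∷ q) disj =
  ∣p∪q∣≡∣p∣+∣q∣ p q (λ k∈p k∈q → disj (there k∈p) (there k∈q))

-- The cardinality is the sum of the indicator function; this lets us use the
-- invariance of finite sums under permutations.
indicator : Bool → ℕ
indicator true  = 1
indicator false = 0

∣p∣≡sum : ∀ {n} (p : Subset n) → ∣ p ∣ ≡ sum (λ i → indicator (lookup p i))
∣p∣≡sum []            = refl
∣p∣≡sum (inside ∷ p)  = ≡.cong suc (∣p∣≡sum p)
∣p∣≡sum (outside ∷ p) = ∣p∣≡sum p

∣p∘π∣≡∣p∣ : ∀ {n} (p : Subset n) (π : Permutation n n) →
  ∣ tabulate (λ k → lookup p (π ⟨$⟩ʳ k)) ∣ ≡ ∣ p ∣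
∣p∘π∣≡∣p∣ p π = begin
  ∣ tabulate (λ k → lookup p (π ⟨$⟩ʳ k)) ∣
    ≡⟨ ∣p∣≡sum (tabulate (λ k → lookup p (π ⟨$⟩ʳ k))) ⟩
  sum (λ k → indicator (lookup (tabulate (λ k → lookup p (π ⟨$⟩ʳ k))) k))
    ≡⟨ sum-cong-≗ (λ k → ≡.cong indicator (lookup∘tabulate (λ k → lookup p (π ⟨$⟩ʳ k)) k)) ⟩
  sum (λ k → indicator (lookup p (π ⟨$⟩ʳ k)))
    ≡⟨ ≡.sym (sum-permute (λ i → indicator (lookup p i)) π) ⟩
  sum (λ i → indicator (lookup p i))
    ≡⟨ ≡.sym (∣p∣≡sum p) ⟩
  ∣ p ∣ ∎
  where open ≡.≡-Reasoning

module _ {p : Level} {n : ℕ} {P : Fin n → Set p} (P? : ∀ k → Dec (P k)) where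

  ∈-decided⁻ : ∀ {k} → k ∈ tabulate (λ k → does (P? k)) → P k
  ∈-decided⁻ {k} k∈ = witness (P? k)
    (≡.trans (≡.sym (lookup∘tabulate (λ k → does (P? k)) k)) ([]=⇒lookup k∈))
    where
    witness : (d : Dec (P k)) → does d ≡ true → P k
    witness (yes pk) _ = pk
    witness (no _)   ()

  ∈-decided⁺ : ∀ {k} → P k → k ∈ tabulate (λ k → does (P? k))
  ∈-decided⁺ {k} pk = lookup⇒[]= k _
    (≡.trans (lookup∘tabulate (λ k → does (P? k)) k) (dec-true (P? k) pk))

module SignedSumsetBounds {c ℓ : Level} (G : FiniteAbelianGroup c ℓ) where
  open FiniteAbelianGroup G renaming (refl to ≈-refl; sym to ≈-sym; trans to ≈-trans)
  open import Algebra.Properties.AbelianGroup abGroup using (⁻¹-∙-comm; ⁻¹-involutive)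
  import Relation.Binary.Reasoning.Setoid setoid as ≈-Reasoning

  index : Carrier → Fin order
  index x = proj₁ (strictlySurjective x)

  el-index : ∀ x → el (index x) ≈ x
  el-index x = proj₂ (strictlySurjective x)

  zeroIndex : Fin order
  zeroIndex = index ε

  neg : Fin order → Fin order
  neg k = index (el k ⁻¹)

  neg-involutive : ∀ k → neg (neg k) ≡ k
  neg-involutive k = injective (begin
    el (neg (neg k)) ≈⟨ el-index _ ⟩
    el (neg k) ⁻¹    ≈⟨ ⁻¹-cong (el-index _) ⟩
    el k ⁻¹ ⁻¹       ≈⟨ ⁻¹-involutive (el k) ⟩
    el k             ∎)
    where open ≈-Reasoning

  negate : Subset order → Subset order
  negate A = tabulate (λ k → lookup A (neg k))

  ∣negate∣ : ∀ A → ∣ negate A ∣ ≡ ∣ A ∣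
  ∣negate∣ A = ∣p∘π∣≡∣p∣ A (permutation neg neg neg-involutive neg-involutive)

  ∈negate⁻ : ∀ A {k} → k ∈ negate A → neg k ∈ A
  ∈negate⁻ A {k} k∈-A = lookup⇒[]= (neg k) A
    (≡.trans (≡.sym (lookup∘tabulate (λ k → lookup A (neg k)) k)) ([]=⇒lookup k∈-A))

  sign : Bool → Carrier → Carrier
  sign true  x = x
  sign false x = x ⁻¹

  sign-⁻¹ : ∀ s x → sign s x ⁻¹ ≈ sign (not s) x
  sign-⁻¹ true  x = ≈-refl
  sign-⁻¹ false x = ⁻¹-involutive x

  -- The deciders below are the
  -- very procedures used in Defs, so DiffSet and SignedSumset2 are literally
  -- the subsets they cut out, and membership transfers by ∈-decided.
  InDiffSet : Subset order → Fin order → Set ℓ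
  InDiffSet A k = ∃₂ λ i j → i ∈ A × j ∈ A × el k ≈ el i ∙ el j ⁻¹

  InSignedSumset2 : Subset order → Fin order → Set ℓ
  InSignedSumset2 A k =
    (∃ λ i → i ∈ A × (el k ≈ el i ∙ el i ⊎ el k ≈ (el i ∙ el i) ⁻¹))
    ⊎ (∃₂ λ i j → i ∈ A × j ∈ A × ¬ i ≡ j ×
         (el k ≈ el i ∙ el j ⊎ el k ≈ el i ∙ el j ⁻¹
          ⊎ el k ≈ el i ⁻¹ ∙ el j ⊎ el k ≈ el i ⁻¹ ∙ el j ⁻¹))

  inDiffSet? : ∀ A k → Dec (InDiffSet A k)
  inDiffSet? A k = any? λ i → any? λ j →
    (i ∈? A) ×-dec ((j ∈? A) ×-dec (el k ≈? (el i ∙ el j ⁻¹)))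

  inSignedSumset2? : ∀ A k → Dec (InSignedSumset2 A k)
  inSignedSumset2? A k =
    (any? λ i → (i ∈? A) ×-dec ((el k ≈? (el i ∙ el i)) ⊎-dec (el k ≈? ((el i ∙ el i) ⁻¹))))
    ⊎-dec
    (any? λ i → any? λ j → (i ∈? A) ×-dec ((j ∈? A) ×-dec (¬? (i ≟ᶠ j) ×-dec
      (   (el k ≈? (el i ∙ el j))
      ⊎-dec (el k ≈? (el i ∙ el j ⁻¹))
      ⊎-dec (el k ≈? (el i ⁻¹ ∙ el j))
      ⊎-dec (el k ≈? (el i ⁻¹ ∙ el j ⁻¹))))))

  ∈DiffSet⁻ : ∀ A {k} → k ∈ DiffSet A → InDiffSet A k
  ∈DiffSet⁻ A k∈ = ∈-decided⁻ (inDiffSet? A) k∈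

  ∈2±⁺ : ∀ A {k} → InSignedSumset2 A k → k ∈ SignedSumset2 A
  ∈2±⁺ A = ∈-decided⁺ (inSignedSumset2? A)

  ∈2±-double : ∀ A s {a k} → a ∈ A → el k ≈ sign s (el a) ∙ sign s (el a) → k ∈ SignedSumset2 A
  ∈2±-double A true  a∈A k≈ = ∈2±⁺ A (inj₁ (_ , a∈A , inj₁ k≈))
  ∈2±-double A false a∈A k≈ = ∈2±⁺ A (inj₁ (_ , a∈A , inj₂ (≈-trans k≈ (⁻¹-∙-comm _ _))))

  ∈2±-distinct : ∀ A s t {a b k} → a ∈ A → b ∈ A → ¬ a ≡ b →
    el k ≈ sign s (el a) ∙ sign t (el b) → k ∈ SignedSumset2 A
  ∈2±-distinct A true  true  a∈A b∈A a≢b k≈ =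
    ∈2±⁺ A (inj₂ (_ , _ , a∈A , b∈A , a≢b , inj₁ k≈))
  ∈2±-distinct A true  false a∈A b∈A a≢b k≈ =
    ∈2±⁺ A (inj₂ (_ , _ , a∈A , b∈A , a≢b , inj₂ (inj₁ k≈)))
  ∈2±-distinct A false true  a∈A b∈A a≢b k≈ =
    ∈2±⁺ A (inj₂ (_ , _ , a∈A , b∈A , a≢b , inj₂ (inj₂ (inj₁ k≈))))
  ∈2±-distinct A false false a∈A b∈A a≢b k≈ =
    ∈2±⁺ A (inj₂ (_ , _ , a∈A , b∈A , a≢b , inj₂ (inj₂ (inj₂ k≈))))

  -- A meets its negation -A: some a, b ∈ A (possibly equal) satisfy a + b = 0.
  ZeroSumPair : Subset order → Set ℓ
  ZeroSumPair A = ∃₂ λ a b → a ∈ A × b ∈ A × el a ∙ el b ≈ ε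

  zeroSumPair? : ∀ A → Dec (ZeroSumPair A)
  zeroSumPair? A = any? λ a → any? λ b → (a ∈? A) ×-dec ((b ∈? A) ×-dec ((el a ∙ el b) ≈? ε))

  -- If A meets -A then 0 ∈ 2_± A, as 0 = a + b is 2a or a sum of distinct elements.
  ε∈2± : ∀ A {k} → ZeroSumPair A → el k ≈ ε → k ∈ SignedSumset2 A
  ε∈2± A (a , b , a∈A , b∈A , a+b≈ε) k≈ε with a ≟ᶠ b
  ... | yes refl = ∈2±-double A true a∈A (≈-trans k≈ε (≈-sym a+b≈ε))
  ... | no a≢b   = ∈2±-distinct A true true a∈A b∈A a≢b (≈-trans k≈ε (≈-sym a+b≈ε))

  DiffSet⊆2± : ∀ A → ZeroSumPair A → DiffSet A ⊆ SignedSumset2 A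
  DiffSet⊆2± A pair k∈A-A with ∈DiffSet⁻ A k∈A-A
  ... | i , j , i∈A , j∈A , k≈ with i ≟ᶠ j
  ...   | yes refl = ε∈2± A pair (≈-trans k≈ (inverseʳ (el i)))
  ...   | no i≢j   = ∈2±-distinct A true false i∈A j∈A i≢j k≈

  ∈A∪-A⁻ : ∀ A {k} → k ∈ A ∪ negate A → ∃₂ λ a s → a ∈ A × el k ≈ sign s (el a)
  ∈A∪-A⁻ A {k} k∈ with x∈p∪q⁻ A (negate A) k∈
  ... | inj₁ k∈A  = k , true , k∈A , ≈-refl
  ... | inj₂ k∈-A = neg k , false , ∈negate⁻ A k∈-A , (begin
    el k             ≈⟨ ⁻¹-involutive (el k) ⟨
    el k ⁻¹ ⁻¹       ≈⟨ ⁻¹-cong (el-index (el k ⁻¹)) ⟨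
    el (neg k) ⁻¹    ∎)
    where open ≈-Reasoning

  -- Second case of the proof: (A ∪ -A) - (A ∪ -A) ⊆ {0} ∪ 2_± A, since
  -- (±a) - (±b) is 0 or ±2a when a = b, and ±a ± b otherwise.
  DiffSet⊆0∪2± : ∀ A → DiffSet (A ∪ negate A) ⊆ ⁅ zeroIndex ⁆ ∪ SignedSumset2 A
  DiffSet⊆0∪2± A {k} k∈ with ∈DiffSet⁻ (A ∪ negate A) k∈
  ... | i , j , i∈ , j∈ , k≈ with ∈A∪-A⁻ A i∈ | ∈A∪-A⁻ A j∈
  ...   | a , s , a∈A , i≈ | b , t , b∈A , j≈ = classify s (not t) (a ≟ᶠ b) (begin
    el k                                ≈⟨ k≈ ⟩
    el i ∙ el j ⁻¹                      ≈⟨ ∙-cong i≈ (⁻¹-cong j≈) ⟩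
    sign s (el a) ∙ sign t (el b) ⁻¹    ≈⟨ ∙-congˡ (sign-⁻¹ t (el b)) ⟩
    sign s (el a) ∙ sign (not t) (el b) ∎)
    where
    open ≈-Reasoning
    zero∈ : el k ≈ ε → k ∈ ⁅ zeroIndex ⁆ ∪ SignedSumset2 A
    zero∈ k≈ε = x∈p∪q⁺ (inj₁ (≡.subst (_∈ ⁅ zeroIndex ⁆)
      (injective (≈-trans (el-index ε) (≈-sym k≈ε))) (x∈⁅x⁆ zeroIndex)))

    classify : ∀ s t → Dec (a ≡ b) → el k ≈ sign s (el a) ∙ sign t (el b) →
      k ∈ ⁅ zeroIndex ⁆ ∪ SignedSumset2 A
    classify s     t     (no a≢b)  k≈′ = x∈p∪q⁺ (inj₂ (∈2±-distinct A s t a∈A b∈A a≢b k≈′))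
    classify true  true  (yes refl) k≈′ = x∈p∪q⁺ (inj₂ (∈2±-double A true a∈A k≈′))
    classify false false (yes refl) k≈′ = x∈p∪q⁺ (inj₂ (∈2±-double A false a∈A k≈′))
    classify true  false (yes refl) k≈′ = zero∈ (≈-trans k≈′ (inverseʳ (el a)))
    classify false true  (yes refl) k≈′ = zero∈ (≈-trans k≈′ (inverseˡ (el a)))

  ∣A∪-A∣ : ∀ A → ¬ ZeroSumPair A → ∣ A ∪ negate A ∣ ≡ 2 * ∣ A ∣
  ∣A∪-A∣ A noPair = begin
    ∣ A ∪ negate A ∣      ≡⟨ ∣p∪q∣≡∣p∣+∣q∣ A (negate A) disjoint ⟩
    ∣ A ∣ + ∣ negate A ∣  ≡⟨ ≡.cong (∣ A ∣ +_) (∣negate∣ A) ⟩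
    ∣ A ∣ + ∣ A ∣         ≡⟨ ≡.cong (∣ A ∣ +_) (ℕₚ.+-identityʳ ∣ A ∣) ⟨
    2 * ∣ A ∣             ∎
    where
    open ≡.≡-Reasoning
    disjoint : Disjoint A (negate A)
    disjoint {k} k∈A k∈-A =
      noPair (k , neg k , k∈A , ∈negate⁻ A k∈-A , ≈-trans (∙-congˡ (el-index _)) (inverseʳ (el k)))

  ρ⁻-≤-2±-meeting : ∀ A → ZeroSumPair A → ρ⁻ G ∣ A ∣ ≤ ∣ SignedSumset2 A ∣
  ρ⁻-≤-2±-meeting A pair = ℕₚ.≤-trans
    (minOverSize-≤ order ∣ A ∣ (λ A → ∣ DiffSet A ∣) A refl)
    (p⊆q⇒∣p∣≤∣q∣ (DiffSet⊆2± A pair))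

  ρ⁻-≤-2±-avoiding : ∀ A → ¬ ZeroSumPair A → ρ⁻ G (2 * ∣ A ∣) ∸ 1 ≤ ∣ SignedSumset2 A ∣
  ρ⁻-≤-2±-avoiding A noPair = ℕₚ.m≤n+o⇒m∸n≤o _ 1 (begin
    ρ⁻ G (2 * ∣ A ∣)                       ≤⟨ minOverSize-≤ order (2 * ∣ A ∣) (λ A → ∣ DiffSet A ∣)
                                                 (A ∪ negate A) (∣A∪-A∣ A noPair) ⟩
    ∣ DiffSet (A ∪ negate A) ∣             ≤⟨ p⊆q⇒∣p∣≤∣q∣ (DiffSet⊆0∪2± A) ⟩
    ∣ ⁅ zeroIndex ⁆ ∪ SignedSumset2 A ∣    ≤⟨ ∣p∪q∣≤∣p∣+∣q∣ ⁅ zeroIndex ⁆ (SignedSumset2 A) ⟩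
    ∣ ⁅ zeroIndex ⁆ ∣ + ∣ SignedSumset2 A ∣ ≡⟨ ≡.cong (_+ ∣ SignedSumset2 A ∣) (∣⁅x⁆∣≡1 zeroIndex) ⟩
    1 + ∣ SignedSumset2 A ∣                ∎)
    where open ℕₚ.≤-Reasoning

  ρ⁻-bound-≤-2± : ∀ A → ρ⁻ G ∣ A ∣ ⊓ (ρ⁻ G (2 * ∣ A ∣) ∸ 1) ≤ ∣ SignedSumset2 A ∣
  ρ⁻-bound-≤-2± A with zeroSumPair? A
  ... | yes pair  = ℕₚ.≤-trans (ℕₚ.m⊓n≤m _ _) (ρ⁻-≤-2±-meeting A pair)
  ... | no noPair = ℕₚ.≤-trans (ℕₚ.m⊓n≤n _ _) (ρ⁻-≤-2±-avoiding A noPair)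

-- The bound holds for every A with |A| = m, and it is at most the
-- default value N of the minimum, so it bounds ρ±(G, m, 2).  The argument does
-- not use the hypotheses 1 ≤ m and 2m ≤ N.
lemma8p1 : ∀ {c ℓ : Level} (G : FiniteAbelianGroup c ℓ) (m : ℕ)
    → 1 ≤ m → 2 * m ≤ FiniteAbelianGroup.order G
    → ρ⁻ G m ⊓ (ρ⁻ G (2 * m) ∸ 1) ≤ ρ± G m
lemma8p1 G m _ _ = minOverSize-greatest order m (λ A → ∣ SignedSumset2 A ∣)
  (ℕₚ.≤-trans (ℕₚ.m⊓n≤m _ _) (minOverSize-≤-default order m (λ A → ∣ DiffSet A ∣)))
  (λ { A refl → ρ⁻-bound-≤-2± A })
  where
  open FiniteAbelianGroup G using (order; DiffSet; SignedSumset2)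
  open SignedSumsetBounds G using (ρ⁻-bound-≤-2±)
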